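{- The paramecium graph $PC_3$ satisfies $\sigma^{\square}_V(PC_3)>\sigma^{\times}_V(PC_3)$, and every finite simple connected graph $G$ with fewer vertices than $PC_3$ (i.e. with at most $5$ vertices) satisfies $\sigma^{\square}_V(G)\leq\sigma^{\times}_V(G)$. That is, $PC_3$ is a graph of smallest order whose Cartesian vertex span exceeds its direct vertex span.
   Context: The paramecium graph $PC_3$ is obtained from the triangle on $v_1,v_2,v_3$ by adding three new vertices $u_1,u_2,u_3$ and edges $u_iv_i$ ($i=1,2,3$); it has $6$ vertices. For a finite simple connected graph $G$ with distance $d_G$ and $l\in\mathbb{N}$, let $\mathbb{N}_l=\{1,\dots,l\}$. An $l$-track on $G$ is a surjective $f:\mathbb{N}_l\to V(G)$ with $f(i)f(i+1)\in E(G)$ for all $i<l$; a lazy $l$-track is a surjective $f:\mathbb{N}_l\to V(G)$ with $f(i)f(i+1)\in E(G)$ or $f(i)=f(i+1)$ for all $i<l$; lazy $l$-tracks $f,g$ are opposite if for every $i<l$, either ($f(i)f(i+1)\in E(G)$ and $g(i)=g(i+1)$) or ($g(i)g(i+1)\in E(G)$ and $f(i)=f(i+1)$). Let $m_G(f,g)=\min_{i\in\mathbb{N}_l} d_G(f(i),g(i))$. The direct vertex span $\sigma^{\times}_V(G)$ is the maximum of $m_G(f,g)$ over all $l$ and all pairs of $l$-tracks on $G$; the Cartesian vertex span $\sigma^{\square}_V(G)$ is the maximum of $m_G(f,g)$ over all $l$ and all pairs of opposite lazy $l$-tracks on $G$. -}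

module Defs where

open import Data.Nat using (ℕ; zero; suc; _≤_; _<_)
open import Data.Fin using (Fin; zero; suc; inject₁)
open import Data.Bool using (Bool; true; false; _∨_)
open import Data.Product using (Σ; ∃; _×_; _,_)
open import Data.Sum using (_⊎_)
open import Relation.Binary.PropositionalEquality using (_≡_)

record Graph : Set where
  field
    n      : ℕ
    adj    : Fin n → Fin n → Bool
    sym    : ∀ u v → adj u v ≡ adj v u
    irrefl : ∀ v → adj v v ≡ false

open Graph public

V : Graph → Set
V G = Fin (n G)

Edge : (G : Graph) → V G → V G → Set
Edge G u v = adj G u v ≡ true

data Walk (G : Graph) : V G → V G → ℕ → Set where
  here : ∀ {u} → Walk G u u 0
  step : ∀ {u w v k} → Edge G u w → Walk G w v k → Walk G u v (suc k)

Connected : Graph → Set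
Connected G = ∀ u v → ∃ λ k → Walk G u v k

IsDist : (G : Graph) → V G → V G → ℕ → Set
IsDist G u v k = Walk G u v k × (∀ j → Walk G u v j → k ≤ j)

-- Maps N_l → V(G) with l = suc k; index i : Fin k denotes the step
-- from position (inject₁ i) to position (suc i).
Surjective : ∀ {G : Graph} {l} → (Fin l → V G) → Set
Surjective {G} f = ∀ (v : V G) → ∃ λ i → f i ≡ v

IsTrack : (G : Graph) (k : ℕ) → (Fin (suc k) → V G) → Set
IsTrack G k f = Surjective {G} f × (∀ (i : Fin k) → Edge G (f (inject₁ i)) (f (suc i)))

IsLazyTrack : (G : Graph) (k : ℕ) → (Fin (suc k) → V G) → Set
IsLazyTrack G k f = Surjective {G} f ×
  (∀ (i : Fin k) → Edge G (f (inject₁ i)) (f (suc i)) ⊎ f (inject₁ i) ≡ f (suc i))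

Opposite : (G : Graph) (k : ℕ) → (f g : Fin (suc k) → V G) → Set
Opposite G k f g = ∀ (i : Fin k) →
  (Edge G (f (inject₁ i)) (f (suc i)) × g (inject₁ i) ≡ g (suc i)) ⊎
  (Edge G (g (inject₁ i)) (g (suc i)) × f (inject₁ i) ≡ f (suc i))

IsM : (G : Graph) (k : ℕ) → (f g : Fin (suc k) → V G) → ℕ → Set
IsM G k f g m = (∃ λ i → IsDist G (f i) (g i) m) ×
                (∀ i d → IsDist G (f i) (g i) d → m ≤ d)

DirPair : (G : Graph) (k : ℕ) → (f g : Fin (suc k) → V G) → Set
DirPair G k f g = IsTrack G k f × IsTrack G k g

CartPair : (G : Graph) (k : ℕ) → (f g : Fin (suc k) → V G) → Set
CartPair G k f g = IsLazyTrack G k f × IsLazyTrack G k g × Opposite G k f g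

IsMaxSpan : (G : Graph) → (∀ k → (f g : Fin (suc k) → V G) → Set) → ℕ → Set
IsMaxSpan G Adm s =
  (Σ ℕ λ k → Σ (Fin (suc k) → V G) λ f → Σ (Fin (suc k) → V G) λ g →
     Adm k f g × IsM G k f g s) ×
  (∀ k (f g : Fin (suc k) → V G) m → Adm k f g → IsM G k f g m → m ≤ s)

IsDirectVertexSpan : Graph → ℕ → Set
IsDirectVertexSpan G = IsMaxSpan G (DirPair G)

IsCartesianVertexSpan : Graph → ℕ → Set
IsCartesianVertexSpan G = IsMaxSpan G (CartPair G)

-- The paramecium graph PC_3: vertices 0,1,2 = v1,v2,v3 (triangle),
-- 3,4,5 = u1,u2,u3 with edges u_i v_i.
pcE : Fin 6 → Fin 6 → Bool
pcE zero (suc zero) = true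
pcE zero (suc (suc zero)) = true
pcE (suc zero) (suc (suc zero)) = true
pcE zero (suc (suc (suc zero))) = true
pcE (suc zero) (suc (suc (suc (suc zero)))) = true
pcE (suc (suc zero)) (suc (suc (suc (suc (suc zero))))) = true
pcE _ _ = false

pcAdj : Fin 6 → Fin 6 → Bool
pcAdj u v = pcE u v ∨ pcE v u

private
  ∨-comm : ∀ a b → (a ∨ b) ≡ (b ∨ a)
  ∨-comm false false = Relation.Binary.PropositionalEquality.refl
  ∨-comm false true = Relation.Binary.PropositionalEquality.refl
  ∨-comm true false = Relation.Binary.PropositionalEquality.refl
  ∨-comm true true = Relation.Binary.PropositionalEquality.refl

pcIrrefl : ∀ v → pcAdj v v ≡ false
pcIrrefl zero = Relation.Binary.PropositionalEquality.refl
pcIrrefl (suc zero) = Relation.Binary.PropositionalEquality.refl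
pcIrrefl (suc (suc zero)) = Relation.Binary.PropositionalEquality.refl
pcIrrefl (suc (suc (suc zero))) = Relation.Binary.PropositionalEquality.refl
pcIrrefl (suc (suc (suc (suc zero)))) = Relation.Binary.PropositionalEquality.refl
pcIrrefl (suc (suc (suc (suc (suc zero))))) = Relation.Binary.PropositionalEquality.refl

PC3 : Graph
PC3 = record { n = 6 ; adj = pcAdj ; sym = λ u v → ∨-comm (pcE u v) (pcE v u) ; irrefl = pcIrrefl }

-- Upper bounds of 1 on a span come from an invariant labelling W of the ordered pairs (a , b) at
-- distance at least 2: W is unchanged by every admissible move between two such pairs and W (a , b) ≠ a.
-- Along a pair of tracks that stays at distance at least 2 the label is then constant, so the first
-- track never visits it, contradicting surjectivity.  Such a labelling bounds σ^×(PC₃) by 1, and an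
-- explicit pair of opposite lazy tracks at distance 2 everywhere gives σ^□(PC₃) = 2, the upper bound
-- coming from v₁ being within distance 2 of every vertex.
--
-- Every connected graph with an edge has σ^× ≥ 1: run a closed walk through all vertices against
-- the same walk one step ahead.  An exhaustive search over the graphs on two to five vertices finds
-- a labelling for the Cartesian moves (so σ^□ ≤ 1 ≤ σ^×) for all of them except the twelve labelled
-- 5-cycles c, where f = c₀c₁c₂c₃c₄c₀ and g = c₂c₃c₄c₀c₁c₂ give σ^× ≥ 2 ≥ σ^□.

{-# OPTIONS --safe #-}
module Submission where

open import Data.Bool using (Bool; true; false; T; not; _∧_; _∨_; if_then_else_)
open import Data.Bool.ListAction using (all; any)
open import Data.Bool.Properties using (T-∧; T-∨; T-≡) renaming (_≟_ to _≟ᵇ_)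
open import Data.Fin using (Fin; zero; suc; toℕ; inject₁; #_)
open import Data.Fin.Properties using (_≟_; any?; toℕ-injective)
open import Data.List using (List; []; _∷_; allFin; head; drop)
open import Data.List.Membership.Propositional using (_∈_)
open import Data.List.Membership.Propositional.Properties using (∈-allFin)
open import Data.List.Relation.Unary.All as All using ()
open import Data.List.Relation.Unary.All.Properties using (all⁺)
open import Data.List.Relation.Unary.Any using (here; there; satisfied)
open import Data.List.Relation.Unary.Any.Properties using (any⁻)
open import Data.Maybe using (fromMaybe)
open import Data.Nat
  using (ℕ; zero; suc; _+_; _*_; _^_; _/_; _%_; _≡ᵇ_; _≤_; _<_; z≤n; s≤s; NonZero; _≤?_)
open import Data.Nat.DivMod using (_mod_)
open import Data.Nat.Induction using (<-rec)
open import Data.Nat.Properties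
  using (≤-refl; ≤-trans; ≤-antisym; <⇒≤; ≮⇒≥; ≰⇒>; ≡ᵇ⇒≡; ≡⇒≡ᵇ; anyUpTo?)
open import Data.Product using (Σ; ∃; _×_; _,_; proj₁; proj₂)
open import Data.Sum as Sum using (_⊎_; inj₁; inj₂)
open import Data.Unit using (⊤; tt)
open import Data.Vec using (Vec; []; _∷_; lookup; tabulate)
open import Data.Vec.Properties using (lookup∘tabulate)
open import Function using (_∘_)
open import Function.Bundles using (module Equivalence)
open import Relation.Binary.PropositionalEquality using (_≡_; _≢_; refl; sym; trans; cong; subst)
open import Relation.Nullary using (Dec; yes; no; ¬_; contradiction)
open import Relation.Nullary.Decidable using (map′; _×-dec_; ¬?; decidable-stable)

open import Defs hiding (sym)

open Equivalence using (to; from)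

infixr 4 _⇒ᵇ_
infix 7 _==_

_⇒ᵇ_ : Bool → Bool → Bool
x ⇒ᵇ y = not x ∨ y

T-⇒ᵇ : ∀ {x y} → T (x ⇒ᵇ y) → T x → T y
T-⇒ᵇ {true} y _ = y

T-not : ∀ {x} → T (not x) → ¬ T x
T-not {false} _ ()

T-∧⁻ : ∀ {x y} → T (x ∧ y) → T x × T y
T-∧⁻ = to T-∧

_==_ : ∀ {n} → Fin n → Fin n → Bool
i == j = toℕ i ≡ᵇ toℕ j

==⇒≡ : ∀ {n} {i j : Fin n} → T (i == j) → i ≡ j
==⇒≡ {i = i} {j} t = toℕ-injective (≡ᵇ⇒≡ (toℕ i) (toℕ j) t)

≡⇒== : ∀ {n} {i j : Fin n} → i ≡ j → T (i == j)
≡⇒== {i = i} {j} eq = ≡⇒≡ᵇ (toℕ i) (toℕ j) (cong toℕ eq)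

all-allFin : ∀ {n} (p : Fin n → Bool) → T (all p (allFin n)) → ∀ i → T (p i)
all-allFin {n} p t i = All.lookup (all⁺ p (allFin n) t) (∈-allFin i)

any-allFin : ∀ {n} (p : Fin n → Bool) → T (any p (allFin n)) → ∃ λ i → T (p i)
any-allFin {n} p t = satisfied (any⁻ p (allFin n) t)

module _ (G : Graph) where

  edge-sym : ∀ {u v} → Edge G u v → Edge G v u
  edge-sym {u} {v} e = trans (Graph.sym G v u) e

  edge-irreflexive : ∀ {u} → ¬ Edge G u u
  edge-irreflexive {u} e with trans (sym e) (irrefl G u)
  ... | ()

  edge? : ∀ u v → Dec (Edge G u v)
  edge? u v = adj G u v ≟ᵇ true

  walk? : ∀ k u v → Dec (Walk G u v k)
  walk? zero u v = map′ (λ { refl → here }) (λ { here → refl }) (u ≟ v)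
  walk? (suc k) u v =
    map′ (λ (w , e , p) → step e p) (λ { (step e p) → _ , e , p })
         (any? λ w → edge? u w ×-dec walk? k w v)

  shortest : ∀ {u v j} → Walk G u v j → ∃ λ d → d ≤ j × IsDist G u v d
  shortest {u} {v} {j} = <-rec (λ j → Walk G u v j → ∃ λ d → d ≤ j × IsDist G u v d) search j
    where
    search : ∀ j → (∀ {k} → k < j → Walk G u v k → ∃ λ d → d ≤ k × IsDist G u v d) →
             Walk G u v j → ∃ λ d → d ≤ j × IsDist G u v d
    search j shorter w with anyUpTo? (λ k → walk? k u v) j
    ... | yes (k , k<j , w′) =
      let d , d≤k , dist = shorter k<j w′ in d , ≤-trans d≤k (<⇒≤ k<j) , dist
    ... | no none = j , ≤-refl , w , λ k w′ → ≮⇒≥ λ k<j → none (k , k<j , w′)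

  Far : V G → V G → Set
  Far u v = u ≢ v × ¬ Edge G u v

  far? : ∀ u v → Dec (Far u v)
  far? u v = ¬? (u ≟ v) ×-dec ¬? (edge? u v)

module _ {G : Graph} where

  far⇒2≤length : ∀ {u v j} → Far G u v → Walk G u v j → 2 ≤ j
  far⇒2≤length (u≢v , _) here = contradiction refl u≢v
  far⇒2≤length (_ , ¬e) (step e here) = contradiction e ¬e
  far⇒2≤length _ (step _ (step _ _)) = s≤s (s≤s z≤n)

  edge⇒1≤length : ∀ {u v j} → Edge G u v → Walk G u v j → 1 ≤ j
  edge⇒1≤length e here = contradiction e (edge-irreflexive G)
  edge⇒1≤length _ (step _ _) = s≤s z≤n

  near⇒walk≤1 : ∀ {u v} → ¬ Far G u v → ∃ λ j → j ≤ 1 × Walk G u v j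
  near⇒walk≤1 {u} {v} ¬far with u ≟ v | edge? G u v
  ... | yes refl | _ = 0 , z≤n , here
  ... | no _ | yes e = 1 , ≤-refl , step e here
  ... | no u≢v | no ¬e = contradiction (u≢v , ¬e) ¬far

  first-edge : ∀ {u v k} → Walk G u v k → u ≢ v → ∃ (Edge G u)
  first-edge here u≢v = contradiction refl u≢v
  first-edge (step e _) _ = _ , e

module _ {G : Graph} {k} {f g : Fin (suc k) → V G} where

  m≤length : ∀ {m j} → IsM G k f g m → ∀ i → Walk G (f i) (g i) j → m ≤ j
  m≤length (_ , minimal) i w = let d , d≤j , dist = shortest G w in ≤-trans (minimal i d dist) d≤j

  isM-intro : ∀ {m} i → Walk G (f i) (g i) m →
              (∀ i {j} → Walk G (f i) (g i) j → m ≤ j) → IsM G k f g m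
  isM-intro i w lower = (i , w , λ _ → lower i) , λ i _ dist → lower i (proj₁ dist)

  isM-adjacent : (∀ i → Edge G (f i) (g i)) → IsM G k f g 1
  isM-adjacent adjacent =
    isM-intro zero (step (adjacent zero) here) (λ i → edge⇒1≤length (adjacent i))

  isM-far : (∀ i → Far G (f i) (g i)) → ∀ {i j} → j ≤ 2 → Walk G (f i) (g i) j → IsM G k f g 2
  isM-far far {i} j≤2 w =
    isM-intro i (subst (Walk G (f i) (g i)) j≡2 w) (λ i → far⇒2≤length (far i))
    where j≡2 = ≤-antisym j≤2 (far⇒2≤length (far i) w)

  isM≥2⇒far : ∀ {m} → IsM G k f g m → 2 ≤ m → ∀ i → Far G (f i) (g i)
  isM≥2⇒far isM 2≤m i = decidable-stable (far? G (f i) (g i)) λ ¬far →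
    let j , j≤1 , w = near⇒walk≤1 ¬far in
    contradiction (≤-trans 2≤m (≤-trans (m≤length isM i w) j≤1)) λ { (s≤s ()) }

Bound : (G : Graph) → (∀ k → (f g : Fin (suc k) → V G) → Set) → ℕ → Set
Bound G Adm b = ∀ k (f g : Fin (suc k) → V G) m → Adm k f g → IsM G k f g m → m ≤ b

span≤bound : ∀ {G Adm s b} → IsMaxSpan G Adm s → Bound G Adm b → s ≤ b
span≤bound ((k , f , g , adm , isM) , _) bound = bound k f g _ adm isM

trivial-bound : ∀ {G Adm} → (∀ u v → u ≡ v) → Bound G Adm 0
trivial-bound {G} equal k f g m _ isM =
  m≤length isM zero (subst (λ v → Walk G (f zero) v 0) (equal (f zero) (g zero)) here)

Eccentricity≤ : (G : Graph) → V G → ℕ → Set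
Eccentricity≤ G u e = ∀ v → ∃ λ j → j ≤ e × Walk G u v j

cartesian-bound-by-eccentricity : ∀ {G u e} → Eccentricity≤ G u e → Bound G (CartPair G) e
cartesian-bound-by-eccentricity {G} {u} ecc k f g m ((surj , _) , _) isM =
  let i , fi≡u = surj u ; j , j≤e , w = ecc (g i) in
  ≤-trans (m≤length isM i (subst (λ x → Walk G x (g i) j) (sym fi≡u) w)) j≤e

Move : Graph → Set₁
Move G = V G → V G → V G → V G → Set

MovesAlong : (G : Graph) → Move G → ∀ k → (f g : Fin (suc k) → V G) → Set
MovesAlong G R k f g = ∀ (i : Fin k) → R (f (inject₁ i)) (g (inject₁ i)) (f (suc i)) (g (suc i))

CartesianMove : (G : Graph) → Move G
CartesianMove G a b x y = (Edge G a x × b ≡ y) ⊎ (Edge G b y × a ≡ x)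

DirectMove : (G : Graph) → Move G
DirectMove G a b x y = Edge G a x × Edge G b y

record IsObstruction (G : Graph) (R : Move G) (W : V G → V G → V G) : Set where
  field
    invariant : ∀ {a b x y} → Far G a b → R a b x y → Far G x y → W a b ≡ W x y
    avoided   : ∀ {a b} → Far G a b → W a b ≢ a

constant-along : ∀ {A : Set} {k} (h : Fin (suc k) → A) →
                 (∀ (i : Fin k) → h (inject₁ i) ≡ h (suc i)) → ∀ i → h i ≡ h zero
constant-along h steps zero = refl
constant-along {k = suc k} h steps (suc i) =
  trans (sym (steps i)) (constant-along (h ∘ inject₁) (steps ∘ inject₁) i)

module _ {G : Graph} {R : Move G} {W : V G → V G → V G} (obstruction : IsObstruction G R W) where
  open IsObstruction obstruction

  obstruction⇒near : ∀ {k} {f g : Fin (suc k) → V G} → Surjective {G} {suc k} f → MovesAlong G R k f g →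
                     ¬ (∀ i → Far G (f i) (g i))
  obstruction⇒near {f = f} {g} surj moves far = avoided (far j) (trans (constant j) (sym fj≡c))
    where
    c = W (f zero) (g zero)
    constant : ∀ i → W (f i) (g i) ≡ c
    constant = constant-along (λ i → W (f i) (g i))
                              λ i → invariant (far (inject₁ i)) (moves i) (far (suc i))
    j = proj₁ (surj c)
    fj≡c = proj₂ (surj c)

  obstruction-bound : ∀ {Adm} →
    (∀ {k} {f g : Fin (suc k) → V G} → Adm k f g → Surjective {G} {suc k} f × MovesAlong G R k f g) →
    Bound G Adm 1
  obstruction-bound admissible k f g m adm isM with m ≤? 1
  ... | yes m≤1 = m≤1
  ... | no m≰1 = let surj , moves = admissible adm in
                 contradiction (isM≥2⇒far isM (≰⇒> m≰1)) (obstruction⇒near surj moves)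

cartesian-bound-by-obstruction : ∀ {G W} → IsObstruction G (CartesianMove G) W → Bound G (CartPair G) 1
cartesian-bound-by-obstruction obstruction =
  obstruction-bound obstruction λ ((surj , _) , _ , opposite) → surj , opposite

direct-bound-by-obstruction : ∀ {G W} → IsObstruction G (DirectMove G) W → Bound G (DirPair G) 1
direct-bound-by-obstruction obstruction =
  obstruction-bound obstruction λ ((surj , track-f) , (_ , track-g)) → surj , λ i → track-f i , track-g i

module _ {G : Graph} where

  vertexAt : ∀ {u v k} → Walk G u v k → Fin (suc k) → V G
  vertexAt {u = u} _ zero = u
  vertexAt (step _ w) (suc i) = vertexAt w i

  vertexAt-track : ∀ {u v k} (w : Walk G u v k) (i : Fin k) →
                   Edge G (vertexAt w (inject₁ i)) (vertexAt w (suc i))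
  vertexAt-track (step e _) zero = e
  vertexAt-track (step _ w) (suc i) = vertexAt-track w i

  -- Position i holds the vertex following position i of w; the last position steps back to `back`.
  after : ∀ {u v k} → Walk G u v k → V G → Fin (suc k) → V G
  after here back zero = back
  after (step {w = x} _ _) _ zero = x
  after (step {u = u} _ w) _ (suc i) = after w u i

  after-shift : ∀ {u v k} (w : Walk G u v (suc k)) back (i : Fin (suc k)) →
                after w back (inject₁ i) ≡ vertexAt w (suc i)
  after-shift (step _ _) _ zero = refl
  after-shift (step _ w@(step _ _)) _ (suc i) = after-shift w _ i

  after-track : ∀ {u v k} (w : Walk G u v k) back (i : Fin k) →
                Edge G (after w back (inject₁ i)) (after w back (suc i))
  after-track (step e here) _ zero = edge-sym G e
  after-track (step _ (step e _)) _ zero = e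
  after-track (step _ w) _ (suc i) = after-track w _ i

  after-adjacent : ∀ {u v k back} → Edge G u back → (w : Walk G u v k) →
                   ∀ i → Edge G (vertexAt w i) (after w back i)
  after-adjacent e here zero = e
  after-adjacent _ (step e _) zero = e
  after-adjacent _ (step e w) (suc i) = after-adjacent (edge-sym G e) w i

  _++ʷ_ : ∀ {u v x j k} → Walk G u v j → Walk G v x k → Walk G u x (j + k)
  here ++ʷ w = w
  step e w₁ ++ʷ w₂ = step e (w₁ ++ʷ w₂)

  Visits : ∀ {u v k} → Walk G u v k → V G → Set
  Visits w x = ∃ λ i → vertexAt w i ≡ x

  visits-++ʳ : ∀ {u v x j k y} (w₁ : Walk G u v j) (w₂ : Walk G v x k) →
               Visits w₂ y → Visits (w₁ ++ʷ w₂) y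
  visits-++ʳ here _ visit = visit
  visits-++ʳ (step _ w₁) w₂ visit = let i , eq = visits-++ʳ w₁ w₂ visit in suc i , eq

  module _ (connected : Connected G) where

    tour : (a : V G) → List (V G) → ∃ λ K → Walk G a a K
    tour a [] = 0 , here
    tour a (v ∷ vs) = _ , proj₂ (connected a v) ++ʷ (proj₂ (connected v a) ++ʷ proj₂ (tour a vs))

    tour-visits : ∀ a {vs v} → v ∈ vs → Visits (proj₂ (tour a vs)) v
    tour-visits a {v ∷ vs} (here refl) = visits-++ʳ (proj₂ (connected a v)) _ (zero , refl)
    tour-visits a {x ∷ vs} (there v∈vs) =
      visits-++ʳ (proj₂ (connected a x)) _ (visits-++ʳ (proj₂ (connected x a)) _ (tour-visits a v∈vs))

    -- f walks a, b, a and then tours all vertices, so that g, one step ahead, also visits a.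
    direct-pair-at-distance-one : ∀ {a b} → Edge G a b →
      Σ ℕ λ k → Σ (Fin (suc k) → V G) λ f → Σ (Fin (suc k) → V G) λ g → DirPair G k f g × IsM G k f g 1
    direct-pair-at-distance-one {a} {b} e =
      _ , f , g , ((surj-f , vertexAt-track w) , (surj-g , after-track w b)) ,
      isM-adjacent (after-adjacent e w)
      where
      w = step e (step (edge-sym G e) (proj₂ (tour a (allFin (n G)))))
      f = vertexAt w
      g = after w b
      surj-f : Surjective {G} f
      surj-f v = let i , eq = tour-visits a (∈-allFin v) in suc (suc i) , eq
      surj-g : Surjective {G} g
      surj-g v with surj-f v
      ... | zero , eq = inject₁ (suc zero) , trans (after-shift w b (suc zero)) eq
      ... | suc i , eq = inject₁ i , trans (after-shift w b i) eq

1≤direct-span : ∀ {G u v t} → Connected G → u ≢ v → IsDirectVertexSpan G t → 1 ≤ t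
1≤direct-span {u = u} {v} connected u≢v (_ , bound) =
  let _ , e = first-edge (proj₂ (connected u v)) u≢v
      k , f , g , pair , isM = direct-pair-at-distance-one connected e
  in bound k f g 1 pair isM

opposite⇒cartPair : ∀ {G k} {f g : Fin (suc k) → V G} →
  Surjective {G} f → Surjective {G} g → Opposite G k f g → CartPair G k f g
opposite⇒cartPair surj-f surj-g opposite =
  (surj-f , λ i → Sum.map proj₁ proj₂ (opposite i)) ,
  (surj-g , λ i → Sum.swap (Sum.map proj₂ proj₁ (opposite i))) ,
  opposite

Adjacency : ℕ → Set
Adjacency n = Fin n → Fin n → Bool

module Tests {n} (A : Adjacency n) where

  vertices : List (Fin n)
  vertices = allFin n

  far : Fin n → Fin n → Bool
  far u v = not (u == v) ∧ not (A u v)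

  within : ℕ → Fin n → Fin n → Bool
  within zero u v = u == v
  within (suc k) u v = u == v ∨ any (λ w → A u w ∧ within k w v) vertices

  eccentricity≤ : Fin n → ℕ → Bool
  eccentricity≤ u e = all (within e u) vertices

  obstruction : (Fin n → Fin n → Bool) → (Fin n → Fin n → Fin n) → Bool
  obstruction invariantAt W =
    all (λ a → all (λ b → far a b ⇒ᵇ not (W a b == a) ∧ invariantAt a b) vertices) vertices

  cartesianInvariantAt : (Fin n → Fin n → Fin n) → Fin n → Fin n → Bool
  cartesianInvariantAt W a b =
    all (λ x → (A a x ∧ far x b ⇒ᵇ W a b == W x b) ∧ (A b x ∧ far a x ⇒ᵇ W a b == W a x)) vertices

  directInvariantAt : (Fin n → Fin n → Fin n) → Fin n → Fin n → Bool
  directInvariantAt W a b =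
    all (λ x → all (λ y → A a x ∧ A b y ∧ far x y ⇒ᵇ W a b == W x y) vertices) vertices

  cartesianObstruction : (Fin n → Fin n → Fin n) → Bool
  cartesianObstruction W = obstruction (cartesianInvariantAt W) W

  directObstruction : (Fin n → Fin n → Fin n) → Bool
  directObstruction W = obstruction (directInvariantAt W) W

  module _ {k : ℕ} where

    surjective : (Fin (suc k) → Fin n) → Bool
    surjective f = all (λ v → any (λ i → f i == v) (allFin (suc k))) vertices

    track : (Fin (suc k) → Fin n) → Bool
    track f = all (λ i → A (f (inject₁ i)) (f (suc i))) (allFin k)

    opposite : (f g : Fin (suc k) → Fin n) → Bool
    opposite f g = all (λ i → A (f (inject₁ i)) (f (suc i)) ∧ g (inject₁ i) == g (suc i)
                            ∨ A (g (inject₁ i)) (g (suc i)) ∧ f (inject₁ i) == f (suc i)) (allFin k)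

    farPair : (f g : Fin (suc k) → Fin n) → Bool
    farPair f g = all (λ i → far (f i) (g i)) (allFin (suc k)) ∧ within 2 (f zero) (g zero)

    farDirectPair : (f g : Fin (suc k) → Fin n) → Bool
    farDirectPair f g = track f ∧ track g ∧ surjective f ∧ surjective g ∧ farPair f g

    farCartesianPair : (f g : Fin (suc k) → Fin n) → Bool
    farCartesianPair f g = opposite f g ∧ surjective f ∧ surjective g ∧ farPair f g

module Soundness {G : Graph} (A : Adjacency (n G)) (A≡adj : ∀ u v → A u v ≡ adj G u v) where
  open Tests A

  edge⁺ : ∀ {u v} → T (A u v) → Edge G u v
  edge⁺ {u} {v} t = trans (sym (A≡adj u v)) (to T-≡ t)

  edge⁻ : ∀ {u v} → Edge G u v → T (A u v)
  edge⁻ {u} {v} e = from T-≡ (trans (A≡adj u v) e)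

  far-sound : ∀ {u v} → T (far u v) → Far G u v
  far-sound t =
    let distinct , non-adjacent = T-∧⁻ t in T-not distinct ∘ ≡⇒== , T-not non-adjacent ∘ edge⁻

  far-complete : ∀ {u v} → Far G u v → T (far u v)
  far-complete {u} {v} (u≢v , ¬e) with u == v in eq₁ | A u v in eq₂
  ... | true | _ = contradiction (==⇒≡ (from T-≡ eq₁)) u≢v
  ... | false | true = contradiction (edge⁺ (from T-≡ eq₂)) ¬e
  ... | false | false = tt

  within-sound : ∀ k {u v} → T (within k u v) → ∃ λ j → j ≤ k × Walk G u v j
  within-sound zero t = 0 , z≤n , subst (λ v → Walk G _ v 0) (==⇒≡ t) here
  within-sound (suc k) {u} {v} t with to T-∨ t
  ... | inj₁ eq = 0 , z≤n , subst (λ v → Walk G _ v 0) (==⇒≡ eq) here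
  ... | inj₂ t′ =
    let w , t″ = any-allFin (λ w → A u w ∧ within k w v) t′
        e , rest = T-∧⁻ t″
        j , j≤k , walk = within-sound k rest
    in suc j , s≤s j≤k , step (edge⁺ e) walk

  eccentricity≤-sound : ∀ {u e} → T (eccentricity≤ u e) → Eccentricity≤ G u e
  eccentricity≤-sound {e = e} t v = within-sound e (all-allFin _ t v)

  obstruction-sound : ∀ {R invariantAt W} → T (obstruction invariantAt W) →
    (∀ {a b x y} → T (invariantAt a b) → R a b x y → Far G x y → W a b ≡ W x y) → IsObstruction G R W
  obstruction-sound {W = W} t invariantAt-sound = record
    { invariant = λ far-ab → invariantAt-sound (proj₂ (at far-ab))
    ; avoided   = λ far-ab → T-not (proj₁ (at far-ab)) ∘ ≡⇒==
    }
    where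
    at : ∀ {a b} → Far G a b → T (not (W a b == a)) × T _
    at {a} {b} far-ab = T-∧⁻ (T-⇒ᵇ (all-allFin _ (all-allFin _ t a) b) (far-complete far-ab))

  cartesianObstruction-sound : ∀ {W} → T (cartesianObstruction W) → IsObstruction G (CartesianMove G) W
  cartesianObstruction-sound {W} t = obstruction-sound t invariantAt-sound
    where
    invariantAt-sound : ∀ {a b x y} → T (cartesianInvariantAt W a b) → CartesianMove G a b x y →
                        Far G x y → W a b ≡ W x y
    invariantAt-sound {x = x} t (inj₁ (e , refl)) far-xy =
      ==⇒≡ (T-⇒ᵇ (proj₁ (T-∧⁻ (all-allFin _ t x))) (from T-∧ (edge⁻ e , far-complete far-xy)))
    invariantAt-sound {y = y} t (inj₂ (e , refl)) far-xy =
      ==⇒≡ (T-⇒ᵇ (proj₂ (T-∧⁻ (all-allFin _ t y))) (from T-∧ (edge⁻ e , far-complete far-xy)))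

  directObstruction-sound : ∀ {W} → T (directObstruction W) → IsObstruction G (DirectMove G) W
  directObstruction-sound {W} t = obstruction-sound t invariantAt-sound
    where
    invariantAt-sound : ∀ {a b x y} → T (directInvariantAt W a b) → DirectMove G a b x y →
                        Far G x y → W a b ≡ W x y
    invariantAt-sound {x = x} {y} t (e₁ , e₂) far-xy =
      ==⇒≡ (T-⇒ᵇ (all-allFin _ (all-allFin _ t x) y)
                 (from T-∧ (edge⁻ e₁ , from T-∧ (edge⁻ e₂ , far-complete far-xy))))

  module _ {k : ℕ} where

    surjective-sound : ∀ f → T (surjective {k} f) → Surjective {G} f
    surjective-sound f t v = let i , eq = any-allFin _ (all-allFin _ t v) in i , ==⇒≡ eq

    track-sound : ∀ f → T (track {k} f) → ∀ i → Edge G (f (inject₁ i)) (f (suc i))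
    track-sound f t i = edge⁺ (all-allFin _ t i)

    opposite-sound : ∀ f g → T (opposite {k} f g) → Opposite G k f g
    opposite-sound f g t i with to T-∨ (all-allFin _ t i)
    ... | inj₁ s = let e , eq = T-∧⁻ s in inj₁ (edge⁺ e , ==⇒≡ eq)
    ... | inj₂ s = let e , eq = T-∧⁻ s in inj₂ (edge⁺ e , ==⇒≡ eq)

    farPair-sound : ∀ f g → T (farPair {k} f g) → IsM G k f g 2
    farPair-sound f g t =
      let far-everywhere , near = T-∧⁻ t ; j , j≤2 , w = within-sound 2 near in
      isM-far (λ i → far-sound (all-allFin _ far-everywhere i)) j≤2 w

    farDirectPair-sound : ∀ f g → T (farDirectPair {k} f g) → DirPair G k f g × IsM G k f g 2
    farDirectPair-sound f g t =
      let tf , t₁ = T-∧⁻ t ; tg , t₂ = T-∧⁻ t₁ ; sf , t₃ = T-∧⁻ t₂ ; sg , t₄ = T-∧⁻ t₃ in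
      ((surjective-sound f sf , track-sound f tf) , (surjective-sound g sg , track-sound g tg)) ,
      farPair-sound f g t₄

    farCartesianPair-sound : ∀ f g → T (farCartesianPair {k} f g) → CartPair G k f g × IsM G k f g 2
    farCartesianPair-sound f g t =
      let to , t₁ = T-∧⁻ t ; sf , t₂ = T-∧⁻ t₁ ; sg , t₃ = T-∧⁻ t₂ in
      opposite⇒cartPair {G} (surjective-sound f sf) (surjective-sound g sg) (opposite-sound f g to) ,
      farPair-sound f g t₃

-- Vertices are read off the decimal digits of N, least significant first: labelling N a b is
-- digit a·n + b and sequence N o i is digit o + i (taken modulo n).
digit : ℕ → ℕ → ℕ
digit N zero = N % 10
digit N (suc i) = digit (N / 10) i

vertex : ∀ {n} .{{_ : NonZero n}} → ℕ → Fin n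
vertex d = d mod _

labelling : ∀ {n} .{{_ : NonZero n}} → ℕ → Fin n → Fin n → Fin n
labelling {n} N a b = vertex (digit N (toℕ a * n + toℕ b))

sequence : ∀ {n k} .{{_ : NonZero n}} → ℕ → ℕ → Fin k → Fin n
sequence N offset i = vertex (digit N (offset + toℕ i))

data Certificate : Set where
  obstruction farDirectPair : ℕ → Certificate

certifies : ∀ {n} .{{_ : NonZero n}} → Adjacency n → Certificate → Bool
certifies A (obstruction N) = Tests.cartesianObstruction A (labelling N)
certifies A (farDirectPair N) =
  Tests.farDirectPair A {5} (sequence N 0) (sequence N 6) ∧
  Tests.eccentricity≤ A (sequence {k = 6} N 0 zero) 2

certificate-sound : ∀ {G} .{{_ : NonZero (n G)}} (A : Adjacency (n G)) → (∀ u v → A u v ≡ adj G u v) →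
  Connected G → ∀ {u v : V G} → u ≢ v → ∀ c → T (certifies A c) →
  ∀ {s t} → IsCartesianVertexSpan G s → IsDirectVertexSpan G t → s ≤ t
certificate-sound A A≡adj connected u≢v (obstruction N) t σ□ σ× =
  ≤-trans (span≤bound σ□ (cartesian-bound-by-obstruction (cartesianObstruction-sound {labelling N} t)))
          (1≤direct-span connected u≢v σ×)
  where open Soundness A A≡adj
certificate-sound A A≡adj _ _ (farDirectPair N) t σ□ (_ , bound) =
  let pair , centre = T-∧⁻ t ; dirPair , isM = farDirectPair-sound (sequence N 0) (sequence N 6) pair in
  ≤-trans (span≤bound σ□ (cartesian-bound-by-eccentricity (eccentricity≤-sound centre)))
          (bound 5 _ _ 2 dirPair isM)
  where open Soundness A A≡adj

Triangle : ℕ → Set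
Triangle zero = ⊤
Triangle (suc n) = Vec Bool n × Triangle n

adjacency : ∀ {n} → Triangle n → Adjacency n
adjacency (_ , _) zero zero = false
adjacency (r , _) zero (suc j) = lookup r j
adjacency (r , _) (suc i) zero = lookup r i
adjacency (_ , M) (suc i) (suc j) = adjacency M i j

triangle : ∀ {n} → Adjacency n → Triangle n
triangle {zero} _ = tt
triangle {suc n} A = tabulate (A zero ∘ suc) , triangle (λ i j → A (suc i) (suc j))

adjacency-triangle : ∀ {n} (A : Adjacency n) → (∀ u v → A u v ≡ A v u) → (∀ v → A v v ≡ false) →
                     ∀ u v → adjacency (triangle A) u v ≡ A u v
adjacency-triangle A _ irreflexive zero zero = sym (irreflexive zero)
adjacency-triangle A _ _ zero (suc j) = lookup∘tabulate (A zero ∘ suc) j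
adjacency-triangle A symmetric _ (suc i) zero =
  trans (lookup∘tabulate (A zero ∘ suc) i) (symmetric zero (suc i))
adjacency-triangle A symmetric irreflexive (suc i) (suc j) =
  adjacency-triangle (λ i j → A (suc i) (suc j)) (λ u v → symmetric (suc u) (suc v)) (irreflexive ∘ suc) i j

bits : ∀ {k} → Vec Bool k → ℕ
bits [] = 0
bits (b ∷ v) = (if b then 1 else 0) + 2 * bits v

code : ∀ {n} → Triangle n → ℕ
code {zero} _ = 0
code {suc n} (r , M) = bits r + 2 ^ n * code M

allVecᵇ : ∀ k → (Vec Bool k → Bool) → Bool
allVecᵇ zero p = p []
allVecᵇ (suc k) p = allVecᵇ k (p ∘ (true ∷_)) ∧ allVecᵇ k (p ∘ (false ∷_))

allVecᵇ-sound : ∀ k p → T (allVecᵇ k p) → ∀ v → T (p v)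
allVecᵇ-sound zero p t [] = t
allVecᵇ-sound (suc k) p t (true ∷ v) = allVecᵇ-sound k _ (proj₁ (T-∧⁻ t)) v
allVecᵇ-sound (suc k) p t (false ∷ v) = allVecᵇ-sound k _ (proj₂ (T-∧⁻ t)) v

allTriangleᵇ : ∀ n → (Triangle n → Bool) → Bool
allTriangleᵇ zero p = p tt
allTriangleᵇ (suc n) p = allVecᵇ n λ r → allTriangleᵇ n λ M → p (r , M)

allTriangleᵇ-sound : ∀ n p → T (allTriangleᵇ n p) → ∀ M → T (p M)
allTriangleᵇ-sound zero p t tt = t
allTriangleᵇ-sound (suc n) p t (r , M) = allTriangleᵇ-sound n _ (allVecᵇ-sound n _ t r) M

-- The entry at position code M certifies the graph with adjacency M (found by computer search).
table : ℕ → List Certificate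
table 2 =
  obstruction 10 ∷ obstruction 0 ∷
  []
table 3 =
  obstruction 110 ∷ obstruction 200200 ∷ obstruction 10000010 ∷ obstruction 0 ∷
  obstruction 110 ∷ obstruction 100 ∷ obstruction 10 ∷ obstruction 0 ∷
  []
table 4 =
  obstruction 1110 ∷ obstruction 22002200 ∷ obstruction 101000001010 ∷ obstruction 300030003000 ∷
  obstruction 110000000000110 ∷ obstruction 200000002000200 ∷ obstruction 10001000000010 ∷ obstruction 0 ∷
  obstruction 1110 ∷ obstruction 300030003100 ∷ obstruction 300030003010 ∷ obstruction 300030003000 ∷
  obstruction 110000000000110 ∷ obstruction 110000000000100 ∷ obstruction 110000000000010 ∷ obstruction 0 ∷
  obstruction 1110 ∷ obstruction 200000002001200 ∷ obstruction 101000001010 ∷ obstruction 101000001000 ∷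
  obstruction 200000002000210 ∷ obstruction 200000002000200 ∷ obstruction 101000000010 ∷ obstruction 0 ∷
  obstruction 1110 ∷ obstruction 1100 ∷ obstruction 100000001010 ∷ obstruction 100000001000 ∷
  obstruction 100000000000110 ∷ obstruction 100000000000100 ∷ obstruction 10 ∷ obstruction 0 ∷
  obstruction 1110 ∷ obstruction 22002200 ∷ obstruction 10001000001010 ∷ obstruction 22002000 ∷
  obstruction 10001000000110 ∷ obstruction 22000200 ∷ obstruction 10001000000010 ∷ obstruction 0 ∷
  obstruction 1110 ∷ obstruction 20002200 ∷ obstruction 1010 ∷ obstruction 20002000 ∷
  obstruction 10000000000110 ∷ obstruction 100 ∷ obstruction 10000000000010 ∷ obstruction 0 ∷
  obstruction 1110 ∷ obstruction 2002200 ∷ obstruction 1000001010 ∷ obstruction 1000 ∷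
  obstruction 110 ∷ obstruction 2000200 ∷ obstruction 1000000010 ∷ obstruction 0 ∷
  obstruction 1110 ∷ obstruction 1100 ∷ obstruction 1010 ∷ obstruction 1000 ∷
  obstruction 110 ∷ obstruction 100 ∷ obstruction 10 ∷ obstruction 0 ∷
  []
table 5 =
  obstruction 11110 ∷ obstruction 2220022200 ∷ obstruction 110100000011010 ∷
  obstruction 330003300033000 ∷ obstruction 10110000000000010110 ∷ obstruction 20200000002020020200 ∷
  obstruction 10010100100000010010 ∷ obstruction 40000400004000040000 ∷ obstruction 111000000000000000001110 ∷
  obstruction 220000000000000220002200 ∷ obstruction 101000000010100000001010 ∷ obstruction 300000000030000300003000 ∷
  obstruction 11000110000000000000110 ∷ obstruction 20000200000000020000200 ∷ obstruction 1000010000100000000010 ∷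
  obstruction 0 ∷ obstruction 11110 ∷ obstruction 330003300033100 ∷
  obstruction 330003300033010 ∷ obstruction 330003300033000 ∷ obstruction 10110000000000010110 ∷
  obstruction 40110400004000040100 ∷ obstruction 40110400004000040010 ∷ obstruction 40000400004000040000 ∷
  obstruction 111000000000000000001110 ∷ obstruction 311000000030000300003100 ∷ obstruction 311000000030000300003010 ∷
  obstruction 300000000030000300003000 ∷ obstruction 11000110000000000000110 ∷ obstruction 11000110000000000000100 ∷
  obstruction 11000110000000000000010 ∷ obstruction 0 ∷ obstruction 11110 ∷
  obstruction 20200000002020021200 ∷ obstruction 110100000011010 ∷ obstruction 40000410104000041000 ∷
  obstruction 20200000002020020210 ∷ obstruction 20200000002020020200 ∷ obstruction 40000410104000040010 ∷
  obstruction 40000400004000040000 ∷ obstruction 111000000000000000001110 ∷ obstruction 121000200000000020001200 ∷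
  obstruction 101000000010100000001010 ∷ obstruction 101000000010100000001000 ∷ obstruction 121000200000000020000210 ∷
  obstruction 20000200000000020000200 ∷ obstruction 101000000010100000000010 ∷ obstruction 0 ∷
  obstruction 11110 ∷ obstruction 40000400004000041100 ∷ obstruction 40000410004000041010 ∷
  obstruction 40000410004000041000 ∷ obstruction 40100400004000040110 ∷ obstruction 40100400004000040100 ∷
  obstruction 40000400004000040010 ∷ obstruction 40000400004000040000 ∷ obstruction 111000000000000000001110 ∷
  obstruction 111000000000000000001100 ∷ obstruction 111000000010000000001010 ∷ obstruction 111000000010000000001000 ∷
  obstruction 111000100000000000000110 ∷ obstruction 111000100000000000000100 ∷ obstruction 111000000000000000000010 ∷
  obstruction 0 ∷ obstruction 11110 ∷ obstruction 220000000000000220012200 ∷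
  obstruction 110100000011010 ∷ obstruction 300000000130100300013000 ∷ obstruction 10110000000000010110 ∷
  obstruction 20010210000000020010200 ∷ obstruction 10010100100000010010 ∷ obstruction 10010100100000010000 ∷
  obstruction 220000000000000220002210 ∷ obstruction 220000000000000220002200 ∷ obstruction 300000000130100300003010 ∷
  obstruction 300000000030000300003000 ∷ obstruction 20010210000000020000210 ∷ obstruction 20000200000000020000200 ∷
  obstruction 10010100100000000010 ∷ obstruction 0 ∷ obstruction 11110 ∷
  obstruction 300000000030000300013100 ∷ obstruction 300000000130000300013010 ∷ obstruction 300000000130000300013000 ∷
  obstruction 10110000000000010110 ∷ obstruction 10110000000000010100 ∷ obstruction 10110100000000010010 ∷
  obstruction 10110100000000010000 ∷ obstruction 310000000030000300003110 ∷ obstruction 310000000030000300003100 ∷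
  obstruction 300000000030000300003010 ∷ obstruction 300000000030000300003000 ∷ obstruction 10010110000000000000110 ∷
  obstruction 10010110000000000000100 ∷ obstruction 10110000000000000010 ∷ obstruction 0 ∷
  obstruction 11110 ∷ obstruction 20000200000000020011200 ∷ obstruction 110100000011010 ∷
  obstruction 110100000011000 ∷ obstruction 20010200000000020010210 ∷ obstruction 20010200000000020010200 ∷
  obstruction 10000110100000010010 ∷ obstruction 10000110100000010000 ∷ obstruction 120000200000000020001210 ∷
  obstruction 120000200000000020001200 ∷ obstruction 100000000110100000001010 ∷ obstruction 100000000110100000001000 ∷
  obstruction 20000200000000020000210 ∷ obstruction 20000200000000020000200 ∷ obstruction 110100000000010 ∷
  obstruction 0 ∷ obstruction 11110 ∷ obstruction 11100 ∷
  obstruction 110000000011010 ∷ obstruction 110000000011000 ∷ obstruction 10100000000000010110 ∷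
  obstruction 10100000000000010100 ∷ obstruction 10000100000000010010 ∷ obstruction 10000100000000010000 ∷
  obstruction 110000000000000000001110 ∷ obstruction 110000000000000000001100 ∷ obstruction 100000000010000000001010 ∷
  obstruction 100000000010000000001000 ∷ obstruction 10000100000000000000110 ∷ obstruction 10000100000000000000100 ∷
  obstruction 10 ∷ obstruction 0 ∷ obstruction 11110 ∷
  obstruction 2220022200 ∷ obstruction 10010100100000011010 ∷ obstruction 40000400004220042000 ∷
  obstruction 10010100100000010110 ∷ obstruction 40000400004220040200 ∷ obstruction 10010100100000010010 ∷
  obstruction 40000400004000040000 ∷ obstruction 111000000000000000001110 ∷ obstruction 220000000000000220002200 ∷
  obstruction 111000010000100000001010 ∷ obstruction 220000000000000220002000 ∷ obstruction 111000010000100000000110 ∷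
  obstruction 220000000000000220000200 ∷ obstruction 1000010000100000000010 ∷ obstruction 0 ∷
  obstruction 11110 ∷ obstruction 40000400004200042200 ∷ obstruction 40000400004000041010 ∷
  obstruction 40000400004200042000 ∷ obstruction 40010400004000040110 ∷ obstruction 40000400004000040100 ∷
  obstruction 40010400004000040010 ∷ obstruction 40000400004000040000 ∷ obstruction 111000000000000000001110 ∷
  obstruction 222000000000000200002200 ∷ obstruction 111000000000000000001010 ∷ obstruction 222000000000000200002000 ∷
  obstruction 111000010000000000000110 ∷ obstruction 111000000000000000000100 ∷ obstruction 111000010000000000000010 ∷
  obstruction 0 ∷ obstruction 11110 ∷ obstruction 40000400004020042200 ∷
  obstruction 40000400104000041010 ∷ obstruction 40000400004000041000 ∷ obstruction 40000400004000040110 ∷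
  obstruction 40000400004020040200 ∷ obstruction 40000400104000040010 ∷ obstruction 40000400004000040000 ∷
  obstruction 111000000000000000001110 ∷ obstruction 222000000000000020002200 ∷ obstruction 111000000000100000001010 ∷
  obstruction 111000000000000000001000 ∷ obstruction 111000000000000000000110 ∷ obstruction 222000000000000020000200 ∷
  obstruction 111000000000100000000010 ∷ obstruction 0 ∷ obstruction 11110 ∷
  obstruction 40000400004000041100 ∷ obstruction 40000400004000041010 ∷ obstruction 40000400004000041000 ∷
  obstruction 40000400004000040110 ∷ obstruction 40000400004000040100 ∷ obstruction 40000400004000040010 ∷
  obstruction 40000400004000040000 ∷ obstruction 111000000000000000001110 ∷ obstruction 111000000000000000001100 ∷
  obstruction 111000000000000000001010 ∷ obstruction 111000000000000000001000 ∷ obstruction 111000000000000000000110 ∷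
  obstruction 111000000000000000000100 ∷ obstruction 111000000000000000000010 ∷ obstruction 0 ∷
  obstruction 11110 ∷ obstruction 220000000000000220012200 ∷ obstruction 10010100100000011010 ∷
  obstruction 220210011100100220012000 ∷ obstruction 10010100100000010110 ∷ obstruction 220210010100110220010200 ∷
  obstruction 10010100100000010010 ∷ obstruction 10010100100000010000 ∷ obstruction 220000000000000220002210 ∷
  obstruction 220000000000000220002200 ∷ obstruction 220010011100100220202010 ∷ obstruction 220000000000000220002000 ∷
  obstruction 220010010100110220200210 ∷ obstruction 220000000000000220000200 ∷ obstruction 10010100100000000010 ∷
  obstruction 0 ∷ obstruction 11110 ∷ obstruction 220000000000000200012200 ∷
  obstruction 10010100000000011010 ∷ obstruction 220210011100000200012000 ∷ obstruction 10010100000000010110 ∷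
  obstruction 10010100000000010100 ∷ obstruction 10010100000000010010 ∷ obstruction 10010100000000010000 ∷
  obstruction 220000000000000200002220 ∷ obstruction 220000000000000200002200 ∷ obstruction 220000000000000200002010 ∷
  obstruction 220000000000000200002000 ∷ farDirectPair 230412041230 ∷ obstruction 220000000000000200000200 ∷
  obstruction 10010100000000000010 ∷ obstruction 0 ∷ obstruction 11110 ∷
  obstruction 220000000000000020012200 ∷ obstruction 10000100100000011010 ∷ obstruction 10000100100000011000 ∷
  obstruction 10000100100000010110 ∷ obstruction 220210000100110020010200 ∷ obstruction 10000100100000010010 ∷
  obstruction 10000100100000010000 ∷ obstruction 220000000000000020002220 ∷ obstruction 220000000000000020002200 ∷
  farDirectPair 320413041320 ∷ obstruction 220000000000000020002000 ∷ obstruction 220000000000000020000210 ∷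
  obstruction 220000000000000020000200 ∷ obstruction 10000100100000000010 ∷ obstruction 0 ∷
  obstruction 11110 ∷ obstruction 11100 ∷ obstruction 10000100000000011010 ∷
  obstruction 10000100000000011000 ∷ obstruction 10000100000000010110 ∷ obstruction 10000100000000010100 ∷
  obstruction 10000100000000010010 ∷ obstruction 10000100000000010000 ∷ obstruction 110000000000000000001110 ∷
  obstruction 110000000000000000001100 ∷ obstruction 110000000000000000001010 ∷ obstruction 110000000000000000001000 ∷
  obstruction 110000000000000000000110 ∷ obstruction 110000000000000000000100 ∷ obstruction 10 ∷
  obstruction 0 ∷ obstruction 11110 ∷ obstruction 2220022200 ∷
  obstruction 101000000010100000011010 ∷ obstruction 300000000030002320023000 ∷ obstruction 10110000000000010110 ∷
  obstruction 20200000002020020200 ∷ obstruction 1010110000100000010010 ∷ obstruction 20200000002020020000 ∷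
  obstruction 101000000010100000001110 ∷ obstruction 300000000030002320003200 ∷ obstruction 101000000010100000001010 ∷
  obstruction 300000000030000300003000 ∷ obstruction 1010110000100000000110 ∷ obstruction 20200000002020000200 ∷
  obstruction 1000010000100000000010 ∷ obstruction 0 ∷ obstruction 11110 ∷
  obstruction 300000000030002300023200 ∷ obstruction 300000000030000300013010 ∷ obstruction 300000000030002300023000 ∷
  obstruction 10110000000000010110 ∷ obstruction 20220000002000020200 ∷ obstruction 10110000000000010010 ∷
  obstruction 20220000002000020000 ∷ obstruction 301000000030000300003110 ∷ obstruction 300000000030000300003100 ∷
  obstruction 301000000030000300003010 ∷ obstruction 300000000030000300003000 ∷ obstruction 1010110000000000000110 ∷
  obstruction 10110000000000000100 ∷ obstruction 1010110000000000000010 ∷ obstruction 0 ∷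
  obstruction 11110 ∷ obstruction 20200000002020021200 ∷ obstruction 101000000010100000011010 ∷
  obstruction 101120202010102020021000 ∷ obstruction 20200000002020020210 ∷ obstruction 20200000002020020200 ∷
  obstruction 101120200010102020220010 ∷ obstruction 20200000002020020000 ∷ obstruction 101000000010100000001110 ∷
  obstruction 101020202010112020001200 ∷ obstruction 101000000010100000001010 ∷ obstruction 101000000010100000001000 ∷
  obstruction 101020200010112020200210 ∷ obstruction 20200000002020000200 ∷ obstruction 101000000010100000000010 ∷
  obstruction 0 ∷ obstruction 11110 ∷ obstruction 20200000002000021200 ∷
  obstruction 101000000010000000011010 ∷ obstruction 101120202010002000021000 ∷ obstruction 20200000002000020220 ∷
  obstruction 20200000002000020200 ∷ obstruction 20200000002000020010 ∷ obstruction 20200000002000020000 ∷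
  obstruction 101000000010000000001110 ∷ obstruction 101000000010000000001100 ∷ obstruction 101000000010000000001010 ∷
  obstruction 101000000010000000001000 ∷ farDirectPair 130421042130 ∷ obstruction 20200000002000000200 ∷
  obstruction 101000000010000000000010 ∷ obstruction 0 ∷ obstruction 11110 ∷
  obstruction 300000000030000320023200 ∷ obstruction 300000000030100300013010 ∷ obstruction 300000000030000300013000 ∷
  obstruction 10110000000000010110 ∷ obstruction 20220000000020020200 ∷ obstruction 10110000100000010010 ∷
  obstruction 10110000000000010000 ∷ obstruction 300000000030000300003110 ∷ obstruction 300000000030000320003200 ∷
  obstruction 300000000030100300003010 ∷ obstruction 300000000030000300003000 ∷ obstruction 10110000000000000110 ∷
  obstruction 20220000000020000200 ∷ obstruction 10110000100000000010 ∷ obstruction 0 ∷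
  obstruction 11110 ∷ obstruction 300000000030000300013100 ∷ obstruction 300000000030000300013010 ∷
  obstruction 300000000030000300013000 ∷ obstruction 10110000000000010110 ∷ obstruction 10110000000000010100 ∷
  obstruction 10110000000000010010 ∷ obstruction 10110000000000010000 ∷ obstruction 300000000030000300003110 ∷
  obstruction 300000000030000300003100 ∷ obstruction 300000000030000300003010 ∷ obstruction 300000000030000300003000 ∷
  obstruction 10110000000000000110 ∷ obstruction 10110000000000000100 ∷ obstruction 10110000000000000010 ∷
  obstruction 0 ∷ obstruction 11110 ∷ obstruction 20200000000020021200 ∷
  obstruction 100000000010100000011010 ∷ obstruction 100000000010100000011000 ∷ obstruction 20200000000020020220 ∷
  obstruction 20200000000020020200 ∷ farDirectPair 420314031420 ∷ obstruction 20200000000020020000 ∷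
  obstruction 100000000010100000001110 ∷ obstruction 100020202010110020001200 ∷ obstruction 100000000010100000001010 ∷
  obstruction 100000000010100000001000 ∷ obstruction 20200000000020000210 ∷ obstruction 20200000000020000200 ∷
  obstruction 100000000010100000000010 ∷ obstruction 0 ∷ obstruction 11110 ∷
  obstruction 11100 ∷ obstruction 100000000010000000011010 ∷ obstruction 100000000010000000011000 ∷
  obstruction 10100000000000010110 ∷ obstruction 10100000000000010100 ∷ obstruction 10100000000000010010 ∷
  obstruction 10100000000000010000 ∷ obstruction 100000000010000000001110 ∷ obstruction 100000000010000000001100 ∷
  obstruction 100000000010000000001010 ∷ obstruction 100000000010000000001000 ∷ obstruction 10100000000000000110 ∷
  obstruction 10100000000000000100 ∷ obstruction 10 ∷ obstruction 0 ∷
  obstruction 11110 ∷ obstruction 2220022200 ∷ obstruction 1000010000100000011010 ∷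
  obstruction 2220022000 ∷ obstruction 1010010000100000010110 ∷ obstruction 20000000002220020200 ∷
  obstruction 1010010000100000010010 ∷ obstruction 20000000002220020000 ∷ obstruction 101000010000100000001110 ∷
  obstruction 200000000000002220002200 ∷ obstruction 101000010000100000001010 ∷ obstruction 200000000000002220002000 ∷
  obstruction 1000010000100000000110 ∷ obstruction 2220000200 ∷ obstruction 1000010000100000000010 ∷
  obstruction 0 ∷ obstruction 11110 ∷ obstruction 2200022200 ∷
  obstruction 11010 ∷ obstruction 2200022000 ∷ obstruction 10010000000000010110 ∷
  obstruction 20000000002000020200 ∷ obstruction 10010000000000010010 ∷ obstruction 20000000002000020000 ∷
  obstruction 101000000000000000001110 ∷ obstruction 200000000000000200002200 ∷ obstruction 101000000000000000001010 ∷
  obstruction 200000000000000200002000 ∷ obstruction 1000010000000000000110 ∷ obstruction 100 ∷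
  obstruction 1000010000000000000010 ∷ obstruction 0 ∷ obstruction 11110 ∷
  obstruction 20000000002020022200 ∷ obstruction 101000000000100000011010 ∷ obstruction 20000000002020021000 ∷
  obstruction 20000000002020020210 ∷ obstruction 20000000002020020200 ∷ obstruction 101120000000102020220010 ∷
  obstruction 20000000002020020000 ∷ obstruction 101000000000100000001110 ∷ farDirectPair 310423042310 ∷
  obstruction 101000000000100000001010 ∷ obstruction 101000000000100000001000 ∷ obstruction 101000000000100000000110 ∷
  obstruction 20000000002020000200 ∷ obstruction 101000000000100000000010 ∷ obstruction 0 ∷
  obstruction 11110 ∷ obstruction 20000000002000022200 ∷ obstruction 11010 ∷
  obstruction 20000000002000021000 ∷ obstruction 20000000002000020220 ∷ obstruction 20000000002000020200 ∷
  obstruction 20000000002000020010 ∷ obstruction 20000000002000020000 ∷ obstruction 101000000000000000001110 ∷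
  obstruction 101000000000000000001100 ∷ obstruction 101000000000000000001010 ∷ obstruction 101000000000000000001000 ∷
  obstruction 101000000000000000000110 ∷ obstruction 100 ∷ obstruction 101000000000000000000010 ∷
  obstruction 0 ∷ obstruction 11110 ∷ obstruction 200000000000000220022200 ∷
  obstruction 10010000100000011010 ∷ obstruction 200000000000000220012000 ∷ obstruction 10010000100000010110 ∷
  farDirectPair 410324032410 ∷ obstruction 10010000100000010010 ∷ obstruction 10010000100000010000 ∷
  obstruction 200000000000000220002210 ∷ obstruction 200000000000000220002200 ∷ obstruction 200010011000100220202010 ∷
  obstruction 200000000000000220002000 ∷ obstruction 10010000100000000110 ∷ obstruction 200000000000000220000200 ∷
  obstruction 10010000100000000010 ∷ obstruction 0 ∷ obstruction 11110 ∷
  obstruction 200000000000000200022200 ∷ obstruction 11010 ∷ obstruction 200000000000000200012000 ∷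
  obstruction 10010000000000010110 ∷ obstruction 10010000000000010100 ∷ obstruction 10010000000000010010 ∷
  obstruction 10010000000000010000 ∷ obstruction 200000000000000200002220 ∷ obstruction 200000000000000200002200 ∷
  obstruction 200000000000000200002010 ∷ obstruction 200000000000000200002000 ∷ obstruction 10010000000000000110 ∷
  obstruction 100 ∷ obstruction 10010000000000000010 ∷ obstruction 0 ∷
  obstruction 11110 ∷ obstruction 20022200 ∷ obstruction 100000011010 ∷
  obstruction 11000 ∷ obstruction 10000000000000010110 ∷ obstruction 20000000000020020200 ∷
  obstruction 10000000100000010010 ∷ obstruction 10000000000000010000 ∷ obstruction 100000000000000000001110 ∷
  obstruction 200000000000000020002200 ∷ obstruction 100000000000100000001010 ∷ obstruction 100000000000000000001000 ∷
  obstruction 110 ∷ obstruction 20000200 ∷ obstruction 100000000010 ∷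
  obstruction 0 ∷ obstruction 11110 ∷ obstruction 11100 ∷
  obstruction 11010 ∷ obstruction 11000 ∷ obstruction 10000000000000010110 ∷
  obstruction 10000000000000010100 ∷ obstruction 10000000000000010010 ∷ obstruction 10000000000000010000 ∷
  obstruction 100000000000000000001110 ∷ obstruction 100000000000000000001100 ∷ obstruction 100000000000000000001010 ∷
  obstruction 100000000000000000001000 ∷ obstruction 110 ∷ obstruction 100 ∷
  obstruction 10 ∷ obstruction 0 ∷ obstruction 11110 ∷
  obstruction 2220022200 ∷ obstruction 110100000011010 ∷ obstruction 330003300033000 ∷
  obstruction 11000110000000000010110 ∷ obstruction 20000200000002220020200 ∷ obstruction 1000010110100000010010 ∷
  obstruction 330003300030000 ∷ obstruction 11000110000000000001110 ∷ obstruction 20000200000002220002200 ∷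
  obstruction 1000010110100000001010 ∷ obstruction 330003300003000 ∷ obstruction 11000110000000000000110 ∷
  obstruction 20000200000000020000200 ∷ obstruction 1000010000100000000010 ∷ obstruction 0 ∷
  obstruction 11110 ∷ obstruction 330003300033100 ∷ obstruction 330003300033010 ∷
  obstruction 330003300033000 ∷ obstruction 11000110000000000010110 ∷ obstruction 11100110330033300030100 ∷
  obstruction 11100110330003300330010 ∷ obstruction 330003300030000 ∷ obstruction 11000110000000000001110 ∷
  obstruction 11000111330033300003100 ∷ obstruction 11000111330003300303010 ∷ obstruction 330003300003000 ∷
  obstruction 11000110000000000000110 ∷ obstruction 11000110000000000000100 ∷ obstruction 11000110000000000000010 ∷
  obstruction 0 ∷ obstruction 11110 ∷ obstruction 20000200000002020022200 ∷
  obstruction 110100000011010 ∷ obstruction 330303000033000 ∷ obstruction 20000200000000020010210 ∷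
  obstruction 20000200000002020020200 ∷ obstruction 110100000010010 ∷ obstruction 330303000030000 ∷
  obstruction 21000200000000020001210 ∷ obstruction 20000200000000020001200 ∷ obstruction 1000000110100000001010 ∷
  obstruction 110100000001000 ∷ obstruction 21000200000000020000210 ∷ obstruction 20000200000000020000200 ∷
  obstruction 1000000110100000000010 ∷ obstruction 0 ∷ obstruction 11110 ∷
  obstruction 330003000033100 ∷ obstruction 330003000033030 ∷ obstruction 330003000033000 ∷
  obstruction 11000100000000000010110 ∷ obstruction 11100100330033000030100 ∷ obstruction 330003000030010 ∷
  obstruction 330003000030000 ∷ obstruction 11000100000000000001110 ∷ obstruction 11000100000000000001100 ∷
  farDirectPair 120431043120 ∷ obstruction 330003000003000 ∷ obstruction 11000100000000000000110 ∷
  obstruction 11000100000000000000100 ∷ obstruction 11000100000000000000010 ∷ obstruction 0 ∷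
  obstruction 11110 ∷ obstruction 20000200000000220022200 ∷ obstruction 110100000011010 ∷
  obstruction 330300300033000 ∷ obstruction 20000210000000020010210 ∷ obstruction 20000200000000020010200 ∷
  obstruction 10110100000010010 ∷ obstruction 110100000010000 ∷ obstruction 20000200000000020001210 ∷
  obstruction 20000200000000220002200 ∷ obstruction 110100000001010 ∷ obstruction 330300300003000 ∷
  obstruction 20000210000000020000210 ∷ obstruction 20000200000000020000200 ∷ obstruction 10110100000000010 ∷
  obstruction 0 ∷ obstruction 11110 ∷ obstruction 330000300033100 ∷
  obstruction 330000300033030 ∷ obstruction 330000300033000 ∷ obstruction 10000110000000000010110 ∷
  obstruction 10000110000000000010100 ∷ farDirectPair 120341034120 ∷ obstruction 330000300030000 ∷
  obstruction 10000110000000000001110 ∷ obstruction 10000111330030300003100 ∷ obstruction 330000300003010 ∷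
  obstruction 330000300003000 ∷ obstruction 10000110000000000000110 ∷ obstruction 10000110000000000000100 ∷
  obstruction 10000110000000000000010 ∷ obstruction 0 ∷ obstruction 11110 ∷
  obstruction 20000200000000020011200 ∷ obstruction 110100000011010 ∷ obstruction 110100000011000 ∷
  obstruction 20000200000000020010210 ∷ obstruction 20000200000000020010200 ∷ obstruction 110100000010010 ∷
  obstruction 110100000010000 ∷ obstruction 20000200000000020001210 ∷ obstruction 20000200000000020001200 ∷
  obstruction 110100000001010 ∷ obstruction 110100000001000 ∷ obstruction 20000200000000020000210 ∷
  obstruction 20000200000000020000200 ∷ obstruction 110100000000010 ∷ obstruction 0 ∷
  obstruction 11110 ∷ obstruction 11100 ∷ obstruction 110000000011010 ∷
  obstruction 110000000011000 ∷ obstruction 10000100000000000010110 ∷ obstruction 10000100000000000010100 ∷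
  obstruction 110000000010010 ∷ obstruction 110000000010000 ∷ obstruction 10000100000000000001110 ∷
  obstruction 10000100000000000001100 ∷ obstruction 110000000001010 ∷ obstruction 110000000001000 ∷
  obstruction 10000100000000000000110 ∷ obstruction 10000100000000000000100 ∷ obstruction 10 ∷
  obstruction 0 ∷ obstruction 11110 ∷ obstruction 2220022200 ∷
  obstruction 1000010100100000011010 ∷ obstruction 300003330033000 ∷ obstruction 1000010000100000010110 ∷
  obstruction 2220020200 ∷ obstruction 1000010100100000010010 ∷ obstruction 300003330030000 ∷
  obstruction 11000010000100000001110 ∷ obstruction 20000000000002220002200 ∷ obstruction 1000010000100000001010 ∷
  obstruction 2220002000 ∷ obstruction 11000010000100000000110 ∷ obstruction 20000000000002220000200 ∷
  obstruction 1000010000100000000010 ∷ obstruction 0 ∷ obstruction 11110 ∷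
  obstruction 300003300033300 ∷ obstruction 300003300033010 ∷ obstruction 300003300033000 ∷
  obstruction 11000010000000000010110 ∷ obstruction 300003300030100 ∷ obstruction 11100010300003300330010 ∷
  obstruction 300003300030000 ∷ obstruction 11000010000000000001110 ∷ farDirectPair 210432043210 ∷
  obstruction 11000010000000000001010 ∷ obstruction 300003300003000 ∷ obstruction 11000010000000000000110 ∷
  obstruction 11000010000000000000100 ∷ obstruction 11000010000000000000010 ∷ obstruction 0 ∷
  obstruction 11110 ∷ obstruction 2020022200 ∷ obstruction 100100000011010 ∷
  obstruction 300003000033000 ∷ obstruction 10110 ∷ obstruction 2020020200 ∷
  obstruction 100100000010010 ∷ obstruction 300003000030000 ∷ obstruction 11000000000000000001110 ∷
  obstruction 20000000000000020002200 ∷ obstruction 1000000000100000001010 ∷ obstruction 1000 ∷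
  obstruction 11000000000000000000110 ∷ obstruction 20000000000000020000200 ∷ obstruction 1000000000100000000010 ∷
  obstruction 0 ∷ obstruction 11110 ∷ obstruction 300003000033300 ∷
  obstruction 300003000033030 ∷ obstruction 300003000033000 ∷ obstruction 10110 ∷
  obstruction 300003000030100 ∷ obstruction 300003000030010 ∷ obstruction 300003000030000 ∷
  obstruction 11000000000000000001110 ∷ obstruction 11000000000000000001100 ∷ obstruction 11000000000000000001010 ∷
  obstruction 1000 ∷ obstruction 11000000000000000000110 ∷ obstruction 11000000000000000000100 ∷
  obstruction 11000000000000000000010 ∷ obstruction 0 ∷ obstruction 11110 ∷
  obstruction 20000000000000220022200 ∷ obstruction 10100100000011010 ∷ farDirectPair 410234023410 ∷
  obstruction 10100100000010110 ∷ obstruction 20000000000000220010200 ∷ obstruction 10100100000010010 ∷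
  obstruction 10100100000010000 ∷ obstruction 20000000000000220002210 ∷ obstruction 20000000000000220002200 ∷
  obstruction 10100100000001010 ∷ obstruction 20000000000000220002000 ∷ obstruction 20000010100110220200210 ∷
  obstruction 20000000000000220000200 ∷ obstruction 10100100000000010 ∷ obstruction 0 ∷
  obstruction 11110 ∷ obstruction 200022200 ∷ obstruction 100000000011010 ∷
  obstruction 300000300033000 ∷ obstruction 10000000000010110 ∷ obstruction 10100 ∷
  obstruction 10100000000010010 ∷ obstruction 100000000010000 ∷ obstruction 10000000000000000001110 ∷
  obstruction 20000000000000200002200 ∷ obstruction 1010 ∷ obstruction 200002000 ∷
  obstruction 10000010000000000000110 ∷ obstruction 10000000000000000000100 ∷ obstruction 10000000000000010 ∷
  obstruction 0 ∷ obstruction 11110 ∷ obstruction 20000000000000020022200 ∷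
  obstruction 100100000011010 ∷ obstruction 100100000011000 ∷ obstruction 10110 ∷
  obstruction 20000000000000020010200 ∷ obstruction 100100000010010 ∷ obstruction 100100000010000 ∷
  obstruction 20000000000000020002220 ∷ obstruction 20000000000000020002200 ∷ obstruction 100100000001010 ∷
  obstruction 1000 ∷ obstruction 20000000000000020000210 ∷ obstruction 20000000000000020000200 ∷
  obstruction 100100000000010 ∷ obstruction 0 ∷ obstruction 11110 ∷
  obstruction 11100 ∷ obstruction 100000000011010 ∷ obstruction 100000000011000 ∷
  obstruction 10110 ∷ obstruction 10100 ∷ obstruction 100000000010010 ∷
  obstruction 100000000010000 ∷ obstruction 10000000000000000001110 ∷ obstruction 10000000000000000001100 ∷
  obstruction 1010 ∷ obstruction 1000 ∷ obstruction 10000000000000000000110 ∷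
  obstruction 10000000000000000000100 ∷ obstruction 10 ∷ obstruction 0 ∷
  obstruction 11110 ∷ obstruction 2220022200 ∷ obstruction 1000010010100000011010 ∷
  obstruction 30003330033000 ∷ obstruction 1000110000100000010110 ∷ obstruction 200000002220020200 ∷
  obstruction 1000010000100000010010 ∷ obstruction 2220020000 ∷ obstruction 1000010000100000001110 ∷
  obstruction 2220002200 ∷ obstruction 1000010010100000001010 ∷ obstruction 30003330003000 ∷
  obstruction 1000110000100000000110 ∷ obstruction 200000002220000200 ∷ obstruction 1000010000100000000010 ∷
  obstruction 0 ∷ obstruction 11110 ∷ obstruction 30003300033300 ∷
  obstruction 30003300033010 ∷ obstruction 30003300033000 ∷ obstruction 1000110000000000010110 ∷
  farDirectPair 210342034210 ∷ obstruction 1000110000000000010010 ∷ obstruction 30003300030000 ∷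
  obstruction 1000110000000000001110 ∷ obstruction 30003300003100 ∷ obstruction 1000111030003300303010 ∷
  obstruction 30003300003000 ∷ obstruction 1000110000000000000110 ∷ obstruction 1000110000000000000100 ∷
  obstruction 1000110000000000000010 ∷ obstruction 0 ∷ obstruction 11110 ∷
  obstruction 200000002020022200 ∷ obstruction 1000000010100000011010 ∷ farDirectPair 310243024310 ∷
  obstruction 200000002020020210 ∷ obstruction 200000002020020200 ∷ obstruction 1000000010100000010010 ∷
  obstruction 200000002020020000 ∷ obstruction 1000000010100000001110 ∷ obstruction 200000002020001200 ∷
  obstruction 1000000010100000001010 ∷ obstruction 1000000010100000001000 ∷ obstruction 1000200010112020200210 ∷
  obstruction 200000002020000200 ∷ obstruction 1000000010100000000010 ∷ obstruction 0 ∷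
  obstruction 11110 ∷ obstruction 2000022200 ∷ obstruction 10000000011010 ∷
  obstruction 30003000033000 ∷ obstruction 100000000000010110 ∷ obstruction 200000002000020200 ∷
  obstruction 10010 ∷ obstruction 2000020000 ∷ obstruction 1000000000000000001110 ∷
  obstruction 1100 ∷ obstruction 1000000010000000001010 ∷ obstruction 10000000001000 ∷
  obstruction 1000100000000000000110 ∷ obstruction 100000000000000100 ∷ obstruction 1000000000000000000010 ∷
  obstruction 0 ∷ obstruction 11110 ∷ obstruction 220022200 ∷
  obstruction 10100000011010 ∷ obstruction 30000300033000 ∷ obstruction 110000000000010110 ∷
  obstruction 200000000020020200 ∷ obstruction 10000100000010010 ∷ obstruction 10000 ∷
  obstruction 1110 ∷ obstruction 220002200 ∷ obstruction 10100000001010 ∷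
  obstruction 30000300003000 ∷ obstruction 110000000000000110 ∷ obstruction 200000000020000200 ∷
  obstruction 10000100000000010 ∷ obstruction 0 ∷ obstruction 11110 ∷
  obstruction 30000300033300 ∷ obstruction 30000300033030 ∷ obstruction 30000300033000 ∷
  obstruction 110000000000010110 ∷ obstruction 110000000000010100 ∷ obstruction 110000000000010010 ∷
  obstruction 10000 ∷ obstruction 1110 ∷ obstruction 30000300003100 ∷
  obstruction 30000300003010 ∷ obstruction 30000300003000 ∷ obstruction 110000000000000110 ∷
  obstruction 110000000000000100 ∷ obstruction 110000000000000010 ∷ obstruction 0 ∷
  obstruction 11110 ∷ obstruction 200000000020022200 ∷ obstruction 10100000011010 ∷
  obstruction 10100000011000 ∷ obstruction 200000000020020220 ∷ obstruction 200000000020020200 ∷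
  obstruction 10100000010010 ∷ obstruction 10000 ∷ obstruction 1110 ∷
  obstruction 200000000020001200 ∷ obstruction 10100000001010 ∷ obstruction 10100000001000 ∷
  obstruction 200000000020000210 ∷ obstruction 200000000020000200 ∷ obstruction 10100000000010 ∷
  obstruction 0 ∷ obstruction 11110 ∷ obstruction 11100 ∷
  obstruction 10000000011010 ∷ obstruction 10000000011000 ∷ obstruction 100000000000010110 ∷
  obstruction 100000000000010100 ∷ obstruction 10010 ∷ obstruction 10000 ∷
  obstruction 1110 ∷ obstruction 1100 ∷ obstruction 10000000001010 ∷
  obstruction 10000000001000 ∷ obstruction 100000000000000110 ∷ obstruction 100000000000000100 ∷
  obstruction 10 ∷ obstruction 0 ∷ obstruction 11110 ∷
  obstruction 2220022200 ∷ obstruction 1000010000100000011010 ∷ obstruction 2220022000 ∷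
  obstruction 1000010000100000010110 ∷ obstruction 2220020200 ∷ obstruction 1000010000100000010010 ∷
  obstruction 2220020000 ∷ obstruction 1000010000100000001110 ∷ obstruction 2220002200 ∷
  obstruction 1000010000100000001010 ∷ obstruction 2220002000 ∷ obstruction 1000010000100000000110 ∷
  obstruction 2220000200 ∷ obstruction 1000010000100000000010 ∷ obstruction 0 ∷
  obstruction 11110 ∷ obstruction 2200022200 ∷ obstruction 11010 ∷
  obstruction 2200022000 ∷ obstruction 1000010000000000010110 ∷ obstruction 2200020200 ∷
  obstruction 1000010000000000010010 ∷ obstruction 2200020000 ∷ obstruction 1000010000000000001110 ∷
  obstruction 2200002200 ∷ obstruction 1000010000000000001010 ∷ obstruction 2200002000 ∷
  obstruction 1000010000000000000110 ∷ obstruction 100 ∷ obstruction 1000010000000000000010 ∷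
  obstruction 0 ∷ obstruction 11110 ∷ obstruction 2020022200 ∷
  obstruction 1000000000100000011010 ∷ obstruction 2020022000 ∷ obstruction 10110 ∷
  obstruction 2020020200 ∷ obstruction 1000000000100000010010 ∷ obstruction 2020020000 ∷
  obstruction 1000000000100000001110 ∷ obstruction 2020002200 ∷ obstruction 1000000000100000001010 ∷
  obstruction 1000 ∷ obstruction 1000000000100000000110 ∷ obstruction 2020000200 ∷
  obstruction 1000000000100000000010 ∷ obstruction 0 ∷ obstruction 11110 ∷
  obstruction 2000022200 ∷ obstruction 11010 ∷ obstruction 2000022000 ∷
  obstruction 10110 ∷ obstruction 2000020200 ∷ obstruction 10010 ∷
  obstruction 2000020000 ∷ obstruction 1000000000000000001110 ∷ obstruction 1100 ∷
  obstruction 1000000000000000001010 ∷ obstruction 1000 ∷ obstruction 1000000000000000000110 ∷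
  obstruction 100 ∷ obstruction 1000000000000000000010 ∷ obstruction 0 ∷
  obstruction 11110 ∷ obstruction 220022200 ∷ obstruction 10000100000011010 ∷
  obstruction 220022000 ∷ obstruction 10000100000010110 ∷ obstruction 220020200 ∷
  obstruction 10000100000010010 ∷ obstruction 10000 ∷ obstruction 1110 ∷
  obstruction 220002200 ∷ obstruction 10000100000001010 ∷ obstruction 220002000 ∷
  obstruction 10000100000000110 ∷ obstruction 220000200 ∷ obstruction 10000100000000010 ∷
  obstruction 0 ∷ obstruction 11110 ∷ obstruction 200022200 ∷
  obstruction 11010 ∷ obstruction 200022000 ∷ obstruction 10000000000010110 ∷
  obstruction 10100 ∷ obstruction 10000000000010010 ∷ obstruction 10000 ∷
  obstruction 1110 ∷ obstruction 200002200 ∷ obstruction 1010 ∷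
  obstruction 200002000 ∷ obstruction 10000000000000110 ∷ obstruction 100 ∷
  obstruction 10000000000000010 ∷ obstruction 0 ∷ obstruction 11110 ∷
  obstruction 20022200 ∷ obstruction 100000011010 ∷ obstruction 11000 ∷
  obstruction 10110 ∷ obstruction 20020200 ∷ obstruction 100000010010 ∷
  obstruction 10000 ∷ obstruction 1110 ∷ obstruction 20002200 ∷
  obstruction 100000001010 ∷ obstruction 1000 ∷ obstruction 110 ∷
  obstruction 20000200 ∷ obstruction 100000000010 ∷ obstruction 0 ∷
  obstruction 11110 ∷ obstruction 11100 ∷ obstruction 11010 ∷
  obstruction 11000 ∷ obstruction 10110 ∷ obstruction 10100 ∷
  obstruction 10010 ∷ obstruction 10000 ∷ obstruction 1110 ∷
  obstruction 1100 ∷ obstruction 1010 ∷ obstruction 1000 ∷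
  obstruction 110 ∷ obstruction 100 ∷ obstruction 10 ∷
  obstruction 0 ∷
  []
table _ = []

certificateFor : ∀ {n} → Triangle n → Certificate
certificateFor {n} M = fromMaybe (obstruction 0) (head (drop (code M) (table n)))

certified : ∀ {n} .{{_ : NonZero n}} → 2 ≤ n → n < 6 →
            ∀ (M : Triangle n) → T (certifies (adjacency M) (certificateFor M))
certified {1} (s≤s ()) _
certified {2} _ _ = allTriangleᵇ-sound 2 _ tt
certified {3} _ _ = allTriangleᵇ-sound 3 _ tt
certified {4} _ _ = allTriangleᵇ-sound 4 _ tt
certified {5} _ _ = allTriangleᵇ-sound 5 _ tt
certified {suc (suc (suc (suc (suc (suc _)))))} _ (s≤s (s≤s (s≤s (s≤s (s≤s (s≤s ()))))))

smaller-than-PC3 : ∀ (G : Graph) → Connected G → 1 ≤ n G → n G < n PC3 →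
                   ∀ s t → IsCartesianVertexSpan G s → IsDirectVertexSpan G t → s ≤ t
smaller-than-PC3 (record { n = 1 }) _ _ _ _ _ σ□ _ =
  ≤-trans (span≤bound σ□ (trivial-bound λ { zero zero → refl })) z≤n
smaller-than-PC3 (record { n = suc (suc _) ; adj = A ; sym = symmetric ; irrefl = irreflexive })
                 connected _ n<6 _ _ =
  certificate-sound (adjacency M) (adjacency-triangle A symmetric irreflexive) connected {zero} {suc zero} (λ ())
                    (certificateFor M) (certified (s≤s (s≤s z≤n)) n<6 M)
  where M = triangle A

module _ where
  open Tests pcAdj
  open Soundness {PC3} pcAdj (λ _ _ → refl)

  pc3-cartesian-span : IsCartesianVertexSpan PC3 2
  pc3-cartesian-span =
    (13 , f , g , farCartesianPair-sound f g tt) ,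
    cartesian-bound-by-eccentricity (eccentricity≤-sound {zero} {2} tt)
    where
    f g : Fin 14 → V PC3
    f = lookup (# 0 ∷ # 3 ∷ # 0 ∷ # 2 ∷ # 5 ∷ # 5 ∷ # 5 ∷ # 5 ∷ # 2 ∷ # 1 ∷ # 4 ∷ # 4 ∷ # 4 ∷ # 4 ∷ [])
    g = lookup (# 4 ∷ # 4 ∷ # 4 ∷ # 4 ∷ # 4 ∷ # 1 ∷ # 0 ∷ # 3 ∷ # 3 ∷ # 3 ∷ # 3 ∷ # 0 ∷ # 2 ∷ # 5 ∷ [])

  pc3-direct-span : IsDirectVertexSpan PC3 1
  pc3-direct-span =
    direct-pair-at-distance-one connected {zero} {# 1} refl ,
    direct-bound-by-obstruction (directObstruction-sound {labelling 110000000000000110000} tt)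
    where
    connected : Connected PC3
    connected u v =
      let j , _ , w = eccentricity≤-sound {e = 3} (all-allFin (λ u → eccentricity≤ u 3) tt u) v in j , w

proposition5p5 :
    (Σ ℕ λ s → Σ ℕ λ t →
       IsCartesianVertexSpan PC3 s × IsDirectVertexSpan PC3 t × t < s)
    ×
    (∀ (G : Graph) → Connected G → 1 ≤ n G → n G < n PC3 →
       ∀ s t → IsCartesianVertexSpan G s → IsDirectVertexSpan G t → s ≤ t)
proposition5p5 = (2 , 1 , pc3-cartesian-span , pc3-direct-span , ≤-refl) , smaller-than-PC3
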